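{- Let $I\subseteq\mathbb{Z}^+$ be finite nonempty with $m=\max(I)$. Then for every $0\le k\le m-1$, \[ \overline{a}_k(I)=h_{m-k-1}(P_I,u_{m+1}), \] i.e. $\overline{a}_k(I)$ equals the number of permutations $\pi$ of $[m+1]$ with descent set $I$ such that $\pi_{m+1}=m-k$ (equivalently, exactly $k+1$ of the values $\pi_1,\dots,\pi_m$ exceed $\pi_{m+1}$).
   Context: For a finite set $I\subseteq\mathbb{Z}^+$ let $m=\max(I\cup\{0\})$; for integers $n>m$, $d(I,n)$ is the number of permutations $\pi$ of $[n]$ with descent set $\{i\in[n-1]:\pi_i>\pi_{i+1}\}=I$, and $d(I,n)$ also denotes the unique degree-$m$ polynomial in $n$ agreeing with this count for all $n>m$. Binomial: $\binom{w}{k}=w(w-1)\cdots(w-k+1)/k!$. The coefficients $\overline{a}_k(I)$, $-1\le k\le m-1$, are defined by $d(I,n)=\sum_{k=-1}^{m-1}\overline{a}_k(I)\binom{n-m+k}{k+1}$ (one has $\overline{a}_{ -1}(I)=0$). For a finite poset $P$ and $v\in P$, a linear extension is an order-preserving bijection $\phi:P\to\{1,\dots,|P|\}$, and $h_k(P,v)$ is the number of linear extensions $\phi$ with $\phi(v)-1=k$. $P_I$ is the poset on $\{u_1,\dots,u_{m+1}\}$ generated by the relations $u_i>u_{i+1}$ for $i\in I$ and $u_i<u_{i+1}$ for $i\in[m]\setminus I$. -}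

module Defs where

open import Data.Bool using (Bool; true; false; _∧_; not; if_then_else_)
open import Data.Nat using (ℕ; zero; suc; _+_; _∸_; _⊔_; _<ᵇ_; _≡ᵇ_)
open import Data.Nat.Combinatorics using (_C_)
open import Data.List using (List; []; _∷_; [_]; map; concatMap; filterᵇ; length; foldr; upTo)
open import Relation.Binary.PropositionalEquality using (_≡_)
open import Data.Nat using (_≤_)
open import Data.Integer using (+_)
open import Data.Rational using (ℚ; _/_; 0ℚ) renaming (_+_ to _+ℚ_; _*_ to _*ℚ_)

ℕtoℚ : ℕ → ℚ
ℕtoℚ n = (+ n) / 1

sumℚ : List ℚ → ℚ
sumℚ = foldr _+ℚ_ 0ℚ

range1 : ℕ → List ℕ
range1 n = map suc (upTo n)

tuples : ℕ → List ℕ → List (List ℕ)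
tuples zero    xs = [ [] ]
tuples (suc l) xs = concatMap (λ x → map (x ∷_) (tuples l xs)) xs

all : {A : Set} → (A → Bool) → List A → Bool
all p []       = true
all p (x ∷ xs) = p x ∧ all p xs

any : {A : Set} → (A → Bool) → List A → Bool
any p []       = false
any p (x ∷ xs) = if p x then true else any p xs

elemᵇ : ℕ → List ℕ → Bool
elemᵇ x xs = any (x ≡ᵇ_) xs

distinct : List ℕ → Bool
distinct []       = true
distinct (x ∷ xs) = not (elemᵇ x xs) ∧ distinct xs

-- a permutation of [n], written in one-line notation (π₁,…,πₙ):
-- a length-n list with entries in [n], pairwise distinct.
-- (Candidates are drawn from tuples n (range1 n), so only distinctness is checked.)

descentsFrom : ℕ → List ℕ → List ℕ
descentsFrom i []             = []
descentsFrom i (x ∷ [])       = []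
descentsFrom i (x ∷ y ∷ rest) =
  if y <ᵇ x then i ∷ descentsFrom (suc i) (y ∷ rest)
            else descentsFrom (suc i) (y ∷ rest)

descents : List ℕ → List ℕ
descents π = descentsFrom 1 π

sameSet : List ℕ → List ℕ → Bool
sameSet A B = all (λ a → elemᵇ a B) A ∧ all (λ b → elemᵇ b A) B

-- max (I ∪ {0})
maxL : List ℕ → ℕ
maxL = foldr _⊔_ 0

d : List ℕ → ℕ → ℕ
d I n = length (filterᵇ (λ π → distinct π ∧ sameSet (descents π) I) (tuples n (range1 n)))

-- i-th entry (1-based) of a list, default 0
at : List ℕ → ℕ → ℕ
at []       _             = 0
at (x ∷ xs) zero          = 0
at (x ∷ xs) (suc zero)    = x
at (x ∷ xs) (suc (suc i)) = at xs (suc i)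

-- A bijection φ : P_I → [m+1] is encoded by the list (φ(u₁),…,φ(u_{m+1})).
-- It is order preserving iff it respects every generating relation of P_I:
-- φ(u_i) > φ(u_{i+1}) for i ∈ I, φ(u_i) < φ(u_{i+1}) for i ∈ [m] \ I.
respectsP : List ℕ → ℕ → List ℕ → Bool
respectsP I m φ =
  all (λ i → if elemᵇ i I then at φ (suc i) <ᵇ at φ i
                          else at φ i <ᵇ at φ (suc i)) (range1 m)

-- h_j(P_I, u_{m+1}) : number of linear extensions φ of P_I with φ(u_{m+1}) - 1 = j
h : List ℕ → ℕ → ℕ
h I j = length (filterᵇ (λ φ → distinct φ ∧ respectsP I m φ ∧ (at φ (suc m) ∸ 1 ≡ᵇ j))
                       (tuples (suc m) (range1 (suc m))))
  where m = maxL I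

-- a : coefficient family, with a j standing for ā_{j-1}(I), j = 0,…,m.
-- Expansion: d(I,n) = Σ_{k=-1}^{m-1} ā_k binom(n-m+k, k+1)  for all n > m
-- (with j = k+1: binom((n-m)+j-1, j)).
Expansion : List ℕ → (ℕ → ℚ) → Set
Expansion I a = ∀ (n : ℕ) → suc m ≤ n →
  ℕtoℚ (d I n) ≡ sumℚ (map (λ j → a j *ℚ ℕtoℚ ((((n ∸ m) + j) ∸ 1) C j)) (upTo (suc m)))
  where
    m = maxL I

module Submission where

-- Let E(n, x) count the permutations of [n+1] with descent set I and last letter x (endingAt).
-- Sorting by the last letter, d(I, n+1) = Σ_x E(n, x).  For n > m the last position is not a
-- descent, so standardizing the first n letters gives E(n+1, x) = Σ_{y<x} E(n, y)
-- (endingAt-recursion): the rows E(t+m, ·) form a triangle of iterated prefix sums, and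
-- unfolding them with a hockey-stick kernel (PrefixSumTriangle) yields
--   d(I, t+m+1) = Σ_{j≤m} E(m, m+1-j) · C(t+j, j)   (d-expansion).
-- Linear extensions of P_I are exactly the permutations with descent set I, so
-- E(m, j+1) = h_j(P_I, u_{m+1}) (h≡endingAt); this gives existence.  Uniqueness holds since
-- coefficients in the binomial basis C(t+j, j) are determined by the values for large t
-- (combination-injective, via Pascal's rule).

open import Defs
open import Data.Nat using (ℕ; zero; suc; _+_; _*_; _∸_; _<_; _≤_; _<ᵇ_; _≡ᵇ_; z≤n; s≤s)
import Data.Nat.Properties as ℕₚ
open import Data.Nat.Combinatorics using (_C_; nCk≡nC[n∸k]; nC1≡n; nCk+nC[k+1]≡[n+1]C[k+1])
open import Data.Nat.Coprimality using (1-coprimeTo) renaming (sym to coprime-sym)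
open import Data.Nat.ListAction using (sum)
open import Data.Bool using (Bool; true; false; _∧_; _∨_; not; if_then_else_)
import Data.Bool.Properties as Boolₚ
open import Data.List using (List; []; _∷_; [_]; map; concatMap; filterᵇ; length; upTo; applyUpTo; _++_; _∷ʳ_)
import Data.List.Properties as Listₚ
open import Data.List.Relation.Unary.All using (All; []; _∷_)
open import Data.Product using (Σ; _×_; _,_; proj₁; proj₂)
open import Data.Sum using (inj₁; inj₂)
open import Data.Empty using (⊥-elim)
import Data.Integer as ℤ
import Data.Integer.Properties as ℤₚ
open import Data.Rational using (ℚ; 0ℚ; 1ℚ; mkℚ; _/_) renaming (_+_ to _+ℚ_; _*_ to _*ℚ_)
import Data.Rational.Properties as ℚₚ
open import Relation.Nullary using (yes; no)
open import Relation.Binary.PropositionalEquality using (_≡_; _≢_; refl; sym; trans; cong; cong₂; subst; module ≡-Reasoning)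
open import Algebra.Bundles using (CommutativeMonoid)
open import Algebra.Properties.CommutativeSemigroup ℕₚ.+-commutativeSemigroup
  using () renaming (interchange to +-interchange)
open import Algebra.Properties.Group ℚₚ.+-0-group using () renaming (∙-cancelˡ to +ℚ-cancelˡ; ∙-cancelʳ to +ℚ-cancelʳ)
open import Algebra.Properties.CommutativeSemigroup (CommutativeMonoid.commutativeSemigroup ℚₚ.+-0-commutativeMonoid)
  using () renaming (interchange to +ℚ-interchange)

true≢false : true ≡ false → ∀ {A : Set} → A
true≢false ()

≡ᵇ-refl : ∀ x → (x ≡ᵇ x) ≡ true
≡ᵇ-refl zero    = refl
≡ᵇ-refl (suc x) = ≡ᵇ-refl x

≡ᵇ-sound : ∀ x y → (x ≡ᵇ y) ≡ true → x ≡ y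
≡ᵇ-sound zero    zero    _ = refl
≡ᵇ-sound (suc x) (suc y) e = cong suc (≡ᵇ-sound x y e)

≡ᵇ-sym : ∀ x y → (x ≡ᵇ y) ≡ (y ≡ᵇ x)
≡ᵇ-sym zero    zero    = refl
≡ᵇ-sym zero    (suc y) = refl
≡ᵇ-sym (suc x) zero    = refl
≡ᵇ-sym (suc x) (suc y) = ≡ᵇ-sym x y

≡ᵇ-<ˡ : ∀ a b → a < b → (a ≡ᵇ b) ≡ false
≡ᵇ-<ˡ zero    (suc b) _       = refl
≡ᵇ-<ˡ (suc a) (suc b) (s≤s p) = ≡ᵇ-<ˡ a b p

≡ᵇ-<ʳ : ∀ a b → a < b → (b ≡ᵇ a) ≡ false
≡ᵇ-<ʳ a b p = trans (≡ᵇ-sym b a) (≡ᵇ-<ˡ a b p)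

<ᵇ-complete : ∀ a b → a < b → (a <ᵇ b) ≡ true
<ᵇ-complete zero    (suc b) _       = refl
<ᵇ-complete (suc a) (suc b) (s≤s p) = <ᵇ-complete a b p

<ᵇ-complete-≥ : ∀ a b → b ≤ a → (a <ᵇ b) ≡ false
<ᵇ-complete-≥ a       zero    _       = refl
<ᵇ-complete-≥ (suc a) (suc b) (s≤s p) = <ᵇ-complete-≥ a b p

<ᵇ-sound : ∀ a b → (a <ᵇ b) ≡ true → a < b
<ᵇ-sound zero    (suc b) _ = s≤s z≤n
<ᵇ-sound (suc a) (suc b) e = s≤s (<ᵇ-sound a b e)

<ᵇ-sound-≥ : ∀ a b → (a <ᵇ b) ≡ false → b ≤ a
<ᵇ-sound-≥ a       zero    _ = z≤n
<ᵇ-sound-≥ (suc a) (suc b) e = s≤s (<ᵇ-sound-≥ a b e)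

bool-ext : ∀ {b c : Bool} → (b ≡ true → c ≡ true) → (c ≡ true → b ≡ true) → b ≡ c
bool-ext {true}  {true}  _ _ = refl
bool-ext {false} {false} _ _ = refl
bool-ext {true}  {false} f _ = sym (f refl)
bool-ext {false} {true}  _ g = g refl

∧-elimˡ : ∀ {b c} → (b ∧ c) ≡ true → b ≡ true
∧-elimˡ {true} _ = refl

∧-elimʳ : ∀ {b c} → (b ∧ c) ≡ true → c ≡ true
∧-elimʳ {true} e = e

∧-intro : ∀ {b c} → b ≡ true → c ≡ true → (b ∧ c) ≡ true
∧-intro refl refl = refl

elemᵇ-head : ∀ x xs → elemᵇ x (x ∷ xs) ≡ true
elemᵇ-head x xs rewrite ≡ᵇ-refl x = refl

elemᵇ-tail : ∀ x a xs → elemᵇ x xs ≡ true → elemᵇ x (a ∷ xs) ≡ true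
elemᵇ-tail x a xs e with x ≡ᵇ a
... | true  = refl
... | false = e

all-elim : ∀ (p : ℕ → Bool) xs x → all p xs ≡ true → elemᵇ x xs ≡ true → p x ≡ true
all-elim p (a ∷ xs) x e ex with x ≡ᵇ a in ea
... | true rewrite ≡ᵇ-sound x a ea = ∧-elimˡ e
... | false = all-elim p xs x (∧-elimʳ {p a} e) ex

all-intro : ∀ (p : ℕ → Bool) xs → (∀ x → elemᵇ x xs ≡ true → p x ≡ true) → all p xs ≡ true
all-intro p []       _ = refl
all-intro p (a ∷ xs) h = ∧-intro (h a (elemᵇ-head a xs)) (all-intro p xs (λ x ex → h x (elemᵇ-tail x a xs ex)))

elemᵇ-All : ∀ {Q : ℕ → Set} xs x → All Q xs → elemᵇ x xs ≡ true → Q x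
elemᵇ-All (a ∷ xs) x (qa ∷ qs) ex with x ≡ᵇ a in ea
... | true rewrite ≡ᵇ-sound x a ea = qa
... | false = elemᵇ-All xs x qs ex

elemᵇ-≤maxL : ∀ xs x → elemᵇ x xs ≡ true → x ≤ maxL xs
elemᵇ-≤maxL (a ∷ xs) x ex with x ≡ᵇ a in ea
... | true rewrite ≡ᵇ-sound x a ea = ℕₚ.m≤m⊔n a (maxL xs)
... | false = ℕₚ.≤-trans (elemᵇ-≤maxL xs x ex) (ℕₚ.m≤n⊔m a (maxL xs))

>maxL⇒∉ : ∀ k xs → maxL xs < k → elemᵇ k xs ≡ false
>maxL⇒∉ k []       _ = refl
>maxL⇒∉ k (i ∷ xs) p rewrite ≡ᵇ-<ʳ i k (ℕₚ.≤-<-trans (ℕₚ.m≤m⊔n i (maxL xs)) p) =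
  >maxL⇒∉ k xs (ℕₚ.≤-<-trans (ℕₚ.m≤n⊔m i (maxL xs)) p)

∑ : List ℕ → (ℕ → ℕ) → ℕ
∑ xs f = sum (map f xs)

interval : ℕ → ℕ → List ℕ
interval a zero    = []
interval a (suc k) = a ∷ interval (suc a) k

∑-cong : ∀ xs {f g : ℕ → ℕ} → (∀ x → f x ≡ g x) → ∑ xs f ≡ ∑ xs g
∑-cong []       _ = refl
∑-cong (x ∷ xs) h = cong₂ _+_ (h x) (∑-cong xs h)

∑-zero : ∀ xs → ∑ xs (λ _ → 0) ≡ 0
∑-zero []       = refl
∑-zero (_ ∷ xs) = ∑-zero xs

∑-+ : ∀ xs (f g : ℕ → ℕ) → ∑ xs f + ∑ xs g ≡ ∑ xs (λ x → f x + g x)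
∑-+ []       f g = refl
∑-+ (x ∷ xs) f g = trans (+-interchange (f x) (∑ xs f) (g x) (∑ xs g)) (cong (f x + g x +_) (∑-+ xs f g))

∑-swap : ∀ xs ys (F : ℕ → ℕ → ℕ) → ∑ xs (λ x → ∑ ys (F x)) ≡ ∑ ys (λ y → ∑ xs (λ x → F x y))
∑-swap []       ys F = sym (∑-zero ys)
∑-swap (x ∷ xs) ys F = trans (cong (∑ ys (F x) +_) (∑-swap xs ys F)) (∑-+ ys (F x) (λ y → ∑ xs (λ x' → F x' y)))

∑-*ˡ : ∀ xs c (f : ℕ → ℕ) → c * ∑ xs f ≡ ∑ xs (λ x → c * f x)
∑-*ˡ []       c f = ℕₚ.*-zeroʳ c
∑-*ˡ (x ∷ xs) c f = trans (ℕₚ.*-distribˡ-+ c (f x) (∑ xs f)) (cong (c * f x +_) (∑-*ˡ xs c f))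

∑-map : ∀ (g : ℕ → ℕ) ys (f : ℕ → ℕ) → ∑ (map g ys) f ≡ ∑ ys (λ y → f (g y))
∑-map g []       f = refl
∑-map g (y ∷ ys) f = cong (f (g y) +_) (∑-map g ys f)

∑-filter : ∀ (q : ℕ → Bool) xs (f : ℕ → ℕ) → (∀ z → q z ≡ false → f z ≡ 0) → ∑ xs f ≡ ∑ (filterᵇ q xs) f
∑-filter q []       f _  = refl
∑-filter q (x ∷ xs) f h0 with q x in e
... | true  = cong (f x +_) (∑-filter q xs f h0)
... | false = trans (cong (_+ ∑ xs f) (h0 x e)) (∑-filter q xs f h0)

upTo≡interval : ∀ n → upTo n ≡ interval 0 n
upTo≡interval n = go (λ i → i) 0 n (λ _ → refl)
  where
  go : ∀ (f : ℕ → ℕ) a n → (∀ i → f i ≡ a + i) → applyUpTo f n ≡ interval a n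
  go f a zero    _ = refl
  go f a (suc n) h = cong₂ _∷_ (trans (h 0) (ℕₚ.+-identityʳ a))
    (go (λ i → f (suc i)) (suc a) n (λ i → trans (h (suc i)) (ℕₚ.+-suc a i)))

range1≡interval : ∀ n → range1 n ≡ interval 1 n
range1≡interval n = trans (cong (map suc) (upTo≡interval n)) (map-suc 0 n)
  where
  map-suc : ∀ a n → map suc (interval a n) ≡ interval (suc a) n
  map-suc a zero    = refl
  map-suc a (suc n) = cong (suc a ∷_) (map-suc (suc a) n)

∈interval : ∀ a k i → a ≤ i → i < a + k → elemᵇ i (interval a k) ≡ true
∈interval a zero    i p q = ⊥-elim (ℕₚ.<⇒≱ q (subst (_≤ i) (sym (ℕₚ.+-identityʳ a)) p))
∈interval a (suc k) i p q with i ≡ᵇ a in e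
... | true  = refl
... | false = ∈interval (suc a) k i (ℕₚ.≤∧≢⇒< p (λ { refl → true≢false (trans (sym (≡ᵇ-refl a)) e) }))
                                   (subst (i <_) (ℕₚ.+-suc a k) q)

interval-bounds : ∀ a k i → elemᵇ i (interval a k) ≡ true → (a ≤ i) × (i < a + k)
interval-bounds a (suc k) i ex with i ≡ᵇ a in e
... | true rewrite ≡ᵇ-sound i a e = ℕₚ.≤-refl , subst (a <_) (sym (ℕₚ.+-suc a k)) (s≤s (ℕₚ.m≤m+n a k))
... | false with interval-bounds (suc a) k i ex
...   | p , q = ℕₚ.<⇒≤ p , subst (i <_) (sym (ℕₚ.+-suc a k)) q

∑-interval-cong : ∀ a k (f g : ℕ → ℕ) → (∀ i → a ≤ i → i < a + k → f i ≡ g i) →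
  ∑ (interval a k) f ≡ ∑ (interval a k) g
∑-interval-cong a zero    f g _ = refl
∑-interval-cong a (suc k) f g h =
  cong₂ _+_ (h a ℕₚ.≤-refl (subst (a <_) (sym (ℕₚ.+-suc a k)) (s≤s (ℕₚ.m≤m+n a k))))
            (∑-interval-cong (suc a) k f g (λ i p q → h i (ℕₚ.<⇒≤ p) (subst (i <_) (sym (ℕₚ.+-suc a k)) q)))

∑-interval-shift : ∀ a k (f : ℕ → ℕ) → ∑ (interval (suc a) k) f ≡ ∑ (interval a k) (λ x → f (suc x))
∑-interval-shift a zero    f = refl
∑-interval-shift a (suc k) f = cong (f (suc a) +_) (∑-interval-shift (suc a) k f)

∑-interval-last : ∀ a k (f : ℕ → ℕ) → ∑ (interval a (suc k)) f ≡ ∑ (interval a k) f + f (a + k)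
∑-interval-last a zero    f = trans (ℕₚ.+-identityʳ (f a)) (cong f (sym (ℕₚ.+-identityʳ a)))
∑-interval-last a (suc k) f = begin
  f a + ∑ (interval (suc a) (suc k)) f          ≡⟨ cong (f a +_) (∑-interval-last (suc a) k f) ⟩
  f a + (∑ (interval (suc a) k) f + f (suc a + k)) ≡⟨ sym (ℕₚ.+-assoc (f a) _ _) ⟩
  f a + ∑ (interval (suc a) k) f + f (suc a + k)   ≡⟨ cong (λ z → f a + ∑ (interval (suc a) k) f + f z) (sym (ℕₚ.+-suc a k)) ⟩
  f a + ∑ (interval (suc a) k) f + f (a + suc k) ∎
  where open ≡-Reasoning

∑-interval-reverse : ∀ M (f : ℕ → ℕ) → ∑ (interval 1 M) f ≡ ∑ (interval 0 M) (λ j → f (M ∸ j))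
∑-interval-reverse zero    f = refl
∑-interval-reverse (suc M) f = begin
  ∑ (interval 1 (suc M)) f                              ≡⟨ ∑-interval-last 1 M f ⟩
  ∑ (interval 1 M) f + f (suc M)                        ≡⟨ ℕₚ.+-comm _ (f (suc M)) ⟩
  f (suc M) + ∑ (interval 1 M) f                        ≡⟨ cong (f (suc M) +_) (∑-interval-reverse M f) ⟩
  f (suc M) + ∑ (interval 0 M) (λ j → f (M ∸ j))        ≡⟨ cong (f (suc M) +_) (sym (∑-interval-shift 0 M (λ j → f (suc M ∸ j)))) ⟩
  ∑ (interval 0 (suc M)) (λ j → f (suc M ∸ j)) ∎
  where open ≡-Reasoning

∸-suc : ∀ {a x} → a < x → x ∸ a ≡ suc (x ∸ suc a)
∸-suc {zero}  {suc x} _       = refl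
∸-suc {suc a} {suc x} (s≤s p) = ∸-suc p

∑-below : ∀ a n x (f : ℕ → ℕ) → a ≤ x → x ≤ a + n →
  ∑ (interval a n) (λ y → if y <ᵇ x then f y else 0) ≡ ∑ (interval a (x ∸ a)) f
∑-below a n x f p q with ℕₚ.m≤n⇒m<n∨m≡n p
... | inj₂ refl rewrite ℕₚ.n∸n≡0 a = nothing-below a n ℕₚ.≤-refl
  where
  nothing-below : ∀ b k → a ≤ b → ∑ (interval b k) (λ y → if y <ᵇ a then f y else 0) ≡ 0
  nothing-below b zero    _ = refl
  nothing-below b (suc k) r rewrite <ᵇ-complete-≥ b a r = nothing-below (suc b) k (ℕₚ.m≤n⇒m≤1+n r)
∑-below a zero    x f p q | inj₁ a<x = ⊥-elim (ℕₚ.<⇒≱ a<x (subst (x ≤_) (ℕₚ.+-identityʳ a) q))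
∑-below a (suc n) x f p q | inj₁ a<x rewrite <ᵇ-complete a x a<x | ∸-suc a<x =
  cong (f a +_) (∑-below (suc a) n x f a<x (subst (x ≤_) (ℕₚ.+-suc a n) q))

∑-point : ∀ a k c (f : ℕ → ℕ) → a ≤ c → c < a + k →
  ∑ (interval a k) (λ z → if z ≡ᵇ c then f z else 0) ≡ f c
∑-point a zero    c f p q = ⊥-elim (ℕₚ.<⇒≱ q (subst (_≤ c) (sym (ℕₚ.+-identityʳ a)) p))
∑-point a (suc k) c f p q with ℕₚ.m≤n⇒m<n∨m≡n p
... | inj₂ refl rewrite ≡ᵇ-refl a = trans (cong (f a +_) (none-after (suc a) k (ℕₚ.n<1+n a))) (ℕₚ.+-identityʳ (f a))
  where
  none-after : ∀ b k → a < b → ∑ (interval b k) (λ z → if z ≡ᵇ a then f z else 0) ≡ 0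
  none-after b zero    _ = refl
  none-after b (suc k) r rewrite ≡ᵇ-<ʳ a b r = none-after (suc b) k (ℕₚ.m<n⇒m<1+n r)
... | inj₁ a<c rewrite ≡ᵇ-<ˡ a c a<c = ∑-point (suc a) k c f a<c (subst (c <_) (ℕₚ.+-suc a k) q)

count : (List ℕ → Bool) → List (List ℕ) → ℕ
count p us = length (filterᵇ p us)

countTuples : ℕ → List ℕ → (List ℕ → Bool) → ℕ
countTuples n xs p = count p (tuples n xs)

count-++ : ∀ p (us vs : List (List ℕ)) → count p (us ++ vs) ≡ count p us + count p vs
count-++ p []       vs = refl
count-++ p (u ∷ us) vs with p u
... | true  = cong suc (count-++ p us vs)
... | false = count-++ p us vs

count-map : ∀ p (g : List ℕ → List ℕ) us → count p (map g us) ≡ count (λ u → p (g u)) us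
count-map p g []       = refl
count-map p g (u ∷ us) with p (g u)
... | true  = cong suc (count-map p g us)
... | false = count-map p g us

count-concatMap : ∀ p (f : ℕ → List (List ℕ)) xs → count p (concatMap f xs) ≡ ∑ xs (λ x → count p (f x))
count-concatMap p f []       = refl
count-concatMap p f (x ∷ xs) =
  trans (count-++ p (f x) (concatMap f xs)) (cong (count p (f x) +_) (count-concatMap p f xs))

count-none : ∀ p us → (∀ u → p u ≡ false) → count p us ≡ 0
count-none p []       _ = refl
count-none p (u ∷ us) h with p u | h u
... | false | _ = count-none p us h

count-ext : ∀ (p q : List ℕ → Bool) us → (∀ u → p u ≡ q u) → count p us ≡ count q us
count-ext p q []       _ = refl
count-ext p q (u ∷ us) h with p u | q u | h u
... | true  | true  | _ = cong suc (count-ext p q us h)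
... | false | false | _ = count-ext p q us h

countTuples-cons : ∀ n xs p → countTuples (suc n) xs p ≡ ∑ xs (λ x → countTuples n xs (λ u → p (x ∷ u)))
countTuples-cons n xs p = trans (count-concatMap p (λ x → map (x ∷_) (tuples n xs)) xs)
  (∑-cong xs (λ x → count-map p (x ∷_) (tuples n xs)))

countTuples-ext : ∀ n xs (p q : List ℕ → Bool) → (∀ u → length u ≡ n → p u ≡ q u) →
  countTuples n xs p ≡ countTuples n xs q
countTuples-ext zero    xs p q h with p [] | q [] | h [] refl
... | true  | true  | _ = refl
... | false | false | _ = refl
countTuples-ext (suc n) xs p q h = begin
  countTuples (suc n) xs p                              ≡⟨ countTuples-cons n xs p ⟩
  ∑ xs (λ x → countTuples n xs (λ u → p (x ∷ u)))      ≡⟨ ∑-cong xs (λ x → countTuples-ext n xs _ _ (λ u e → h (x ∷ u) (cong suc e))) ⟩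
  ∑ xs (λ x → countTuples n xs (λ u → q (x ∷ u)))      ≡⟨ sym (countTuples-cons n xs q) ⟩
  countTuples (suc n) xs q ∎
  where open ≡-Reasoning

countTuples-snoc : ∀ n xs p → countTuples (suc n) xs p ≡ ∑ xs (λ x → countTuples n xs (λ u → p (u ∷ʳ x)))
countTuples-snoc zero    xs p = trans (countTuples-cons zero xs p)
  (∑-cong xs (λ x → countTuples-ext zero xs (λ u → p (x ∷ u)) (λ u → p (u ∷ʳ x)) (λ { [] refl → refl })))
countTuples-snoc (suc n) xs p = begin
  countTuples (suc (suc n)) xs p
    ≡⟨ countTuples-cons (suc n) xs p ⟩
  ∑ xs (λ x → countTuples (suc n) xs (λ u → p (x ∷ u)))
    ≡⟨ ∑-cong xs (λ x → countTuples-snoc n xs (λ u → p (x ∷ u))) ⟩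
  ∑ xs (λ x → ∑ xs (λ y → countTuples n xs (λ u → p (x ∷ (u ∷ʳ y)))))
    ≡⟨ ∑-swap xs xs _ ⟩
  ∑ xs (λ y → ∑ xs (λ x → countTuples n xs (λ u → p ((x ∷ u) ∷ʳ y))))
    ≡⟨ ∑-cong xs (λ y → sym (countTuples-cons n xs (λ w → p (w ∷ʳ y)))) ⟩
  ∑ xs (λ y → countTuples (suc n) xs (λ w → p (w ∷ʳ y))) ∎
  where open ≡-Reasoning

countTuples-map : ∀ n (g : ℕ → ℕ) ys p → countTuples n (map g ys) p ≡ countTuples n ys (λ u → p (map g u))
countTuples-map zero    g ys p = countTuples-ext zero ys p (λ u → p (map g u)) (λ { [] refl → refl })
countTuples-map (suc n) g ys p = begin
  countTuples (suc n) (map g ys) p                                    ≡⟨ countTuples-cons n (map g ys) p ⟩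
  ∑ (map g ys) (λ x → countTuples n (map g ys) (λ u → p (x ∷ u)))     ≡⟨ ∑-map g ys _ ⟩
  ∑ ys (λ y → countTuples n (map g ys) (λ u → p (g y ∷ u)))           ≡⟨ ∑-cong ys (λ y → countTuples-map n g ys (λ u → p (g y ∷ u))) ⟩
  ∑ ys (λ y → countTuples n ys (λ u → p (map g (y ∷ u))))             ≡⟨ sym (countTuples-cons n ys (λ u → p (map g u))) ⟩
  countTuples (suc n) ys (λ u → p (map g u)) ∎
  where open ≡-Reasoning

countTuples-∧-const : ∀ n xs (p : List ℕ → Bool) b →
  countTuples n xs (λ u → p u ∧ b) ≡ (if b then countTuples n xs p else 0)
countTuples-∧-const n xs p true  = count-ext _ _ (tuples n xs) (λ u → Boolₚ.∧-identityʳ (p u))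
countTuples-∧-const n xs p false = count-none _ (tuples n xs) (λ u → Boolₚ.∧-zeroʳ (p u))

without : ℕ → List ℕ → List ℕ
without x = filterᵇ (λ z → not (z ≡ᵇ x))

countTuples-without : ∀ n x xs p → (∀ u → elemᵇ x u ≡ true → p u ≡ false) →
  countTuples n xs p ≡ countTuples n (without x xs) p
countTuples-without zero    x xs p _ = refl
countTuples-without (suc n) x xs p h = begin
  countTuples (suc n) xs p                                      ≡⟨ countTuples-cons n xs p ⟩
  ∑ xs (λ z → countTuples n xs (λ u → p (z ∷ u)))               ≡⟨ ∑-cong xs (λ z → countTuples-without n x xs _ (reject z)) ⟩
  ∑ xs (λ z → countTuples n (without x xs) (λ u → p (z ∷ u)))   ≡⟨ ∑-filter _ xs _ starts-with-x ⟩
  ∑ (without x xs) (λ z → countTuples n (without x xs) (λ u → p (z ∷ u))) ≡⟨ sym (countTuples-cons n (without x xs) p) ⟩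
  countTuples (suc n) (without x xs) p ∎
  where
  open ≡-Reasoning
  reject : ∀ z u → elemᵇ x u ≡ true → p (z ∷ u) ≡ false
  reject z u e = h (z ∷ u) (elemᵇ-tail x z u e)
  starts-with-x : ∀ z → not (z ≡ᵇ x) ≡ false → countTuples n (without x xs) (λ u → p (z ∷ u)) ≡ 0
  starts-with-x z e rewrite ≡ᵇ-sound z x (Boolₚ.not-injective e) =
    count-none _ (tuples n (without x xs)) (λ u → h (x ∷ u) (elemᵇ-head x u))

hasDescentSet : List ℕ → List ℕ → Bool
hasDescentSet I π = distinct π ∧ sameSet (descents π) I

endingAt : List ℕ → ℕ → ℕ → ℕ
endingAt I n x = countTuples n (range1 (suc n)) (λ u → hasDescentSet I (u ∷ʳ x))

d-by-last : ∀ I n → d I (suc n) ≡ ∑ (range1 (suc n)) (endingAt I n)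
d-by-last I n = countTuples-snoc n (range1 (suc n)) (hasDescentSet I)

lastL : List ℕ → ℕ
lastL []          = 0
lastL (y ∷ [])    = y
lastL (y ∷ z ∷ w) = lastL (z ∷ w)

lastL-snoc : ∀ u y → lastL (u ∷ʳ y) ≡ y
lastL-snoc []          y = refl
lastL-snoc (a ∷ [])    y = refl
lastL-snoc (a ∷ b ∷ u) y = lastL-snoc (b ∷ u) y

-- skip x is the increasing bijection from ℕ onto ℕ ∖ {x}; it relabels a permutation
-- of [n] as a word on [n+1] ∖ {x}, with the same relative order.
skip : ℕ → ℕ → ℕ
skip x t = if t <ᵇ x then t else suc t

skip-<ᵇ : ∀ x a b → (skip x a <ᵇ skip x b) ≡ (a <ᵇ b)
skip-<ᵇ x a b with a <ᵇ x in ea | b <ᵇ x in eb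
... | true  | true  = refl
... | false | false = refl
... | true  | false = trans (<ᵇ-complete a (suc b) (ℕₚ.≤-trans a<x (ℕₚ.m≤n⇒m≤1+n x≤b)))
                            (sym (<ᵇ-complete a b (ℕₚ.<-≤-trans a<x x≤b)))
  where
  a<x = <ᵇ-sound a x ea
  x≤b = <ᵇ-sound-≥ b x eb
... | false | true  = trans (<ᵇ-complete-≥ (suc a) b (ℕₚ.m≤n⇒m≤1+n (ℕₚ.≤-trans (ℕₚ.<⇒≤ b<x) x≤a)))
                            (sym (<ᵇ-complete-≥ a b (ℕₚ.<⇒≤ (ℕₚ.<-≤-trans b<x x≤a))))
  where
  b<x = <ᵇ-sound b x eb
  x≤a = <ᵇ-sound-≥ a x ea

skip-≡ᵇ : ∀ x a b → (skip x a ≡ᵇ skip x b) ≡ (a ≡ᵇ b)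
skip-≡ᵇ x a b with a <ᵇ x in ea | b <ᵇ x in eb
... | true  | true  = refl
... | false | false = refl
... | true  | false = trans (≡ᵇ-<ˡ a (suc b) (ℕₚ.≤-trans a<x (ℕₚ.m≤n⇒m≤1+n x≤b)))
                            (sym (≡ᵇ-<ˡ a b (ℕₚ.<-≤-trans a<x x≤b)))
  where
  a<x = <ᵇ-sound a x ea
  x≤b = <ᵇ-sound-≥ b x eb
... | false | true  = trans (≡ᵇ-<ʳ b (suc a) (ℕₚ.≤-trans b<x (ℕₚ.m≤n⇒m≤1+n x≤a)))
                            (sym (≡ᵇ-<ʳ b a (ℕₚ.<-≤-trans b<x x≤a)))
  where
  b<x = <ᵇ-sound b x eb
  x≤a = <ᵇ-sound-≥ a x ea

skip-misses : ∀ x t → (x ≡ᵇ skip x t) ≡ false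
skip-misses x t with t <ᵇ x in e
... | true  = ≡ᵇ-<ʳ t x (<ᵇ-sound t x e)
... | false = ≡ᵇ-<ˡ x (suc t) (s≤s (<ᵇ-sound-≥ t x e))

skip-above : ∀ x t → (x <ᵇ skip x t) ≡ not (t <ᵇ x)
skip-above x t with t <ᵇ x in e
... | true  = <ᵇ-complete-≥ x t (ℕₚ.<⇒≤ (<ᵇ-sound t x e))
... | false = <ᵇ-complete x (suc t) (s≤s (<ᵇ-sound-≥ t x e))

descentsFrom-skip : ∀ x i u → descentsFrom i (map (skip x) u) ≡ descentsFrom i u
descentsFrom-skip x i []          = refl
descentsFrom-skip x i (a ∷ [])    = refl
descentsFrom-skip x i (a ∷ b ∷ u) with descentsFrom-skip x (suc i) (b ∷ u)
... | ih rewrite skip-<ᵇ x b a | ih = refl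

elemᵇ-skip : ∀ x a u → elemᵇ (skip x a) (map (skip x) u) ≡ elemᵇ a u
elemᵇ-skip x a []      = refl
elemᵇ-skip x a (b ∷ u) rewrite skip-≡ᵇ x a b | elemᵇ-skip x a u = refl

distinct-skip : ∀ x u → distinct (map (skip x) u) ≡ distinct u
distinct-skip x []      = refl
distinct-skip x (a ∷ u) rewrite elemᵇ-skip x a u | distinct-skip x u = refl

x∉skip : ∀ x u → elemᵇ x (map (skip x) u) ≡ false
x∉skip x []      = refl
x∉skip x (a ∷ u) rewrite skip-misses x a = x∉skip x u

lastL-skip : ∀ x y w → lastL (map (skip x) (y ∷ w)) ≡ skip x (lastL (y ∷ w))
lastL-skip x y []      = refl
lastL-skip x y (z ∷ w) = lastL-skip x z w

elemᵇ-snoc : ∀ y u x → elemᵇ y (u ∷ʳ x) ≡ (elemᵇ y u ∨ (y ≡ᵇ x))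
elemᵇ-snoc y []      x with y ≡ᵇ x
... | true  = refl
... | false = refl
elemᵇ-snoc y (a ∷ u) x with y ≡ᵇ a
... | true  = refl
... | false = elemᵇ-snoc y u x

distinct-snoc : ∀ u x → distinct (u ∷ʳ x) ≡ (distinct u ∧ not (elemᵇ x u))
distinct-snoc []      x = refl
distinct-snoc (a ∷ u) x rewrite elemᵇ-snoc a u x | distinct-snoc u x | ≡ᵇ-sym a x
  with elemᵇ a u | x ≡ᵇ a | distinct u
... | true  | _     | _ = refl
... | false | true  | _ = sym (Boolₚ.∧-zeroʳ _)
... | false | false | _ = refl

descentsFrom-snoc : ∀ i y w x → descentsFrom i ((y ∷ w) ∷ʳ x) ≡
  descentsFrom i (y ∷ w) ++ (if x <ᵇ lastL (y ∷ w) then [ i + length w ] else [])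
descentsFrom-snoc i y [] x rewrite ℕₚ.+-identityʳ i with x <ᵇ y
... | true  = refl
... | false = refl
descentsFrom-snoc i y (z ∷ w) x rewrite descentsFrom-snoc (suc i) z w x | sym (ℕₚ.+-suc i (length w)) with z <ᵇ y
... | true  = refl
... | false = refl

hasDescentSet-repeat : ∀ I x u → elemᵇ x u ≡ true → hasDescentSet I (u ∷ʳ x) ≡ false
hasDescentSet-repeat I x u e rewrite distinct-snoc u x | e | Boolₚ.∧-zeroʳ (distinct u) = refl

distinct-standardize : ∀ x τ → distinct (map (skip x) τ ∷ʳ x) ≡ distinct τ
distinct-standardize x τ rewrite distinct-snoc (map (skip x) τ) x | x∉skip x τ | distinct-skip x τ =
  Boolₚ.∧-identityʳ (distinct τ)

descents-standardize : ∀ x y w → descents (map (skip x) (y ∷ w) ∷ʳ x) ≡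
  descents (y ∷ w) ++ (if lastL (y ∷ w) <ᵇ x then [] else [ suc (length w) ])
descents-standardize x y w
  rewrite descentsFrom-snoc 1 (skip x y) (map (skip x) w) x | lastL-skip x y w
        | skip-above x (lastL (y ∷ w)) | Listₚ.length-map (skip x) w | descentsFrom-skip x 1 (y ∷ w)
  with lastL (y ∷ w) <ᵇ x
... | true  = refl
... | false = refl

sameSet-extra : ∀ D k I → elemᵇ k I ≡ false → sameSet (D ++ [ k ]) I ≡ false
sameSet-extra D k I e = cong (_∧ all (λ b → elemᵇ b (D ++ [ k ])) I) (all-snoc D)
  where
  all-snoc : ∀ D → all (λ a → elemᵇ a I) (D ++ [ k ]) ≡ false
  all-snoc []      rewrite e = refl
  all-snoc (a ∷ D) rewrite all-snoc D = Boolₚ.∧-zeroʳ (elemᵇ a I)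

standardize : ∀ I x y w → maxL I < suc (length w) →
  hasDescentSet I (map (skip x) (y ∷ w) ∷ʳ x) ≡ (hasDescentSet I (y ∷ w) ∧ (lastL (y ∷ w) <ᵇ x))
standardize I x y w mI rewrite distinct-standardize x (y ∷ w) | descents-standardize x y w
  with lastL (y ∷ w) <ᵇ x
... | true  rewrite Listₚ.++-identityʳ (descents (y ∷ w)) = sym (Boolₚ.∧-identityʳ _)
... | false rewrite sameSet-extra (descents (y ∷ w)) (suc (length w)) I (>maxL⇒∉ _ I mI) =
  trans (Boolₚ.∧-zeroʳ _) (sym (Boolₚ.∧-zeroʳ _))

without-interval : ∀ x a k → a ≤ x → x ≤ a + k → without x (interval a (suc k)) ≡ map (skip x) (interval a k)
without-interval x a k p q with ℕₚ.m≤n⇒m<n∨m≡n p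
... | inj₂ refl rewrite ≡ᵇ-refl a = trans (untouched (suc a) k (ℕₚ.n<1+n a)) (sym (shifted a k ℕₚ.≤-refl))
  where
  untouched : ∀ b k → a < b → without a (interval b k) ≡ interval b k
  untouched b zero    _ = refl
  untouched b (suc k) r rewrite ≡ᵇ-<ʳ a b r = cong (b ∷_) (untouched (suc b) k (ℕₚ.m<n⇒m<1+n r))
  shifted : ∀ b k → a ≤ b → map (skip a) (interval b k) ≡ interval (suc b) k
  shifted b zero    _ = refl
  shifted b (suc k) r rewrite <ᵇ-complete-≥ b a r = cong (suc b ∷_) (shifted (suc b) k (ℕₚ.m≤n⇒m≤1+n r))
without-interval x a zero    p q | inj₁ a<x = ⊥-elim (ℕₚ.<⇒≱ a<x (subst (x ≤_) (ℕₚ.+-identityʳ a) q))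
without-interval x a (suc k) p q | inj₁ a<x rewrite ≡ᵇ-<ˡ a x a<x | <ᵇ-complete a x a<x =
  cong (a ∷_) (without-interval x (suc a) k a<x (subst (x ≤_) (ℕₚ.+-suc a k) q))

endingAt-standardize : ∀ I n x → maxL I < n → 1 ≤ x → x ≤ suc n →
  endingAt I n x ≡ countTuples n (range1 n) (λ τ → hasDescentSet I τ ∧ (lastL τ <ᵇ x))
endingAt-standardize I n x mI x≥1 x≤n = begin
  countTuples n (range1 (suc n)) ends-in-x                     ≡⟨ cong (λ l → countTuples n l ends-in-x) (range1≡interval (suc n)) ⟩
  countTuples n (interval 1 (suc n)) ends-in-x                 ≡⟨ countTuples-without n x _ _ (hasDescentSet-repeat I x) ⟩
  countTuples n (without x (interval 1 (suc n))) ends-in-x     ≡⟨ cong (λ l → countTuples n l ends-in-x) (without-interval x 1 n x≥1 x≤n) ⟩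
  countTuples n (map (skip x) (interval 1 n)) ends-in-x        ≡⟨ countTuples-map n (skip x) (interval 1 n) _ ⟩
  countTuples n (interval 1 n) (λ τ → ends-in-x (map (skip x) τ)) ≡⟨ countTuples-ext n (interval 1 n) _ _ standardize′ ⟩
  countTuples n (interval 1 n) standard                        ≡⟨ cong (λ l → countTuples n l standard) (sym (range1≡interval n)) ⟩
  countTuples n (range1 n) standard ∎
  where
  open ≡-Reasoning
  ends-in-x standard : List ℕ → Bool
  ends-in-x u = hasDescentSet I (u ∷ʳ x)
  standard τ = hasDescentSet I τ ∧ (lastL τ <ᵇ x)
  standardize′ : ∀ τ → length τ ≡ n → ends-in-x (map (skip x) τ) ≡ standard τ
  standardize′ []      refl = ⊥-elim (ℕₚ.n≮0 mI)
  standardize′ (y ∷ w) refl = standardize I x y w mI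

endingAt-recursion : ∀ I n x → maxL I < suc n → 1 ≤ x → x ≤ suc (suc n) →
  endingAt I (suc n) x ≡ ∑ (range1 (suc n)) (λ y → if y <ᵇ x then endingAt I n y else 0)
endingAt-recursion I n x mI x≥1 x≤n = begin
  endingAt I (suc n) x
    ≡⟨ endingAt-standardize I (suc n) x mI x≥1 x≤n ⟩
  countTuples (suc n) (range1 (suc n)) (λ τ → hasDescentSet I τ ∧ (lastL τ <ᵇ x))
    ≡⟨ countTuples-snoc n (range1 (suc n)) _ ⟩
  ∑ (range1 (suc n)) (λ y → countTuples n (range1 (suc n)) (λ u → hasDescentSet I (u ∷ʳ y) ∧ (lastL (u ∷ʳ y) <ᵇ x)))
    ≡⟨ ∑-cong (range1 (suc n)) last-is-y ⟩
  ∑ (range1 (suc n)) (λ y → if y <ᵇ x then endingAt I n y else 0) ∎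
  where
  open ≡-Reasoning
  last-is-y : ∀ y → countTuples n (range1 (suc n)) (λ u → hasDescentSet I (u ∷ʳ y) ∧ (lastL (u ∷ʳ y) <ᵇ x))
                  ≡ (if y <ᵇ x then endingAt I n y else 0)
  last-is-y y = trans (count-ext _ _ (tuples n (range1 (suc n)))
                        (λ u → cong (λ z → hasDescentSet I (u ∷ʳ y) ∧ (z <ᵇ x)) (lastL-snoc u y)))
                      (countTuples-∧-const n (range1 (suc n)) (λ u → hasDescentSet I (u ∷ʳ y)) (y <ᵇ x))

descentsFrom-below : ∀ s φ j → j < s → elemᵇ j (descentsFrom s φ) ≡ false
descentsFrom-below s []          j _ = refl
descentsFrom-below s (a ∷ [])    j _ = refl
descentsFrom-below s (a ∷ b ∷ φ) j p with descentsFrom-below (suc s) (b ∷ φ) j (ℕₚ.m<n⇒m<1+n p)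
... | ih with b <ᵇ a
...   | true rewrite ≡ᵇ-<ˡ j s p = ih
...   | false = ih

descentsFrom-beyond : ∀ s φ k → length φ ≤ suc k → elemᵇ (s + k) (descentsFrom s φ) ≡ false
descentsFrom-beyond s []          k _ = refl
descentsFrom-beyond s (a ∷ [])    k _ = refl
descentsFrom-beyond s (a ∷ b ∷ φ) zero    (s≤s ())
descentsFrom-beyond s (a ∷ b ∷ φ) (suc k) (s≤s p) with descentsFrom-beyond (suc s) (b ∷ φ) k p
... | ih rewrite ℕₚ.+-suc s k with b <ᵇ a
...   | true rewrite ≡ᵇ-<ʳ s (suc (s + k)) (s≤s (ℕₚ.m≤m+n s k)) = ih
...   | false = ih

descentsFrom-at : ∀ s φ k → suc k < length φ →
  elemᵇ (s + k) (descentsFrom s φ) ≡ (at φ (suc (suc k)) <ᵇ at φ (suc k))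
descentsFrom-at s (a ∷ []) zero (s≤s ())
descentsFrom-at s (a ∷ b ∷ φ) zero p rewrite ℕₚ.+-identityʳ s with b <ᵇ a
... | true rewrite ≡ᵇ-refl s = refl
... | false = descentsFrom-below (suc s) (b ∷ φ) s (ℕₚ.n<1+n s)
descentsFrom-at s (a ∷ b ∷ φ) (suc k) (s≤s p) with descentsFrom-at (suc s) (b ∷ φ) k p
... | ih rewrite ℕₚ.+-suc s k with b <ᵇ a
...   | true rewrite ≡ᵇ-<ʳ s (suc (s + k)) (s≤s (ℕₚ.m≤m+n s k)) = ih
...   | false = ih

is-descent : ∀ φ i → 1 ≤ i → i < length φ → elemᵇ i (descents φ) ≡ (at φ (suc i) <ᵇ at φ i)
is-descent φ (suc k) _ q = descentsFrom-at 1 φ k q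

descent-range : ∀ φ i → elemᵇ i (descents φ) ≡ true → (1 ≤ i) × (i < length φ)
descent-range φ zero    e = true≢false (trans (sym e) (descentsFrom-below 1 φ 0 (s≤s z≤n)))
descent-range φ (suc k) e with suc k ℕₚ.<? length φ
... | yes q = s≤s z≤n , q
... | no q  = true≢false (trans (sym e) (descentsFrom-beyond 1 φ k (ℕₚ.≮⇒≥ q)))

distinct-neighbours : ∀ φ i → 1 ≤ i → i < length φ → distinct φ ≡ true → (at φ i ≡ᵇ at φ (suc i)) ≡ false
distinct-neighbours φ (suc k) _ = go φ k
  where
  go : ∀ φ k → suc k < length φ → distinct φ ≡ true → (at φ (suc k) ≡ᵇ at φ (suc (suc k))) ≡ false
  go (a ∷ [])    zero    (s≤s ()) _
  go (a ∷ b ∷ φ) zero    _       e with a ≡ᵇ b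
  ... | true  = true≢false (sym e)
  ... | false = refl
  go (a ∷ b ∷ φ) (suc k) (s≤s p) e = go (b ∷ φ) k p (∧-elimʳ {not (elemᵇ a (b ∷ φ))} e)

relation : List ℕ → List ℕ → ℕ → Bool
relation I φ i = if elemᵇ i I then at φ (suc i) <ᵇ at φ i else at φ i <ᵇ at φ (suc i)

relation-holds : ∀ I φ i → 1 ≤ i → i < length φ → distinct φ ≡ true →
  (relation I φ i ≡ true → elemᵇ i (descents φ) ≡ elemᵇ i I) ×
  (elemᵇ i (descents φ) ≡ elemᵇ i I → relation I φ i ≡ true)
relation-holds I φ i i≥1 i<len dis rewrite is-descent φ i i≥1 i<len with elemᵇ i I
... | true  = (λ r → r) , (λ r → r)
... | false = (λ r → <ᵇ-complete-≥ (at φ (suc i)) (at φ i) (ℕₚ.<⇒≤ (<ᵇ-sound _ _ r)))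
            , (λ r → <ᵇ-complete _ _ (ℕₚ.≤∧≢⇒< (<ᵇ-sound-≥ _ _ r)
                       (λ eq → true≢false (trans (sym (≡ᵇ-refl (at φ i)))
                                  (trans (cong (at φ i ≡ᵇ_) eq) (distinct-neighbours φ i i≥1 i<len dis))))))

∈range1 : ∀ m i → 1 ≤ i → i ≤ m → elemᵇ i (range1 m) ≡ true
∈range1 m i p q rewrite range1≡interval m = ∈interval 1 m i p (s≤s q)

range1-bounds : ∀ m i → elemᵇ i (range1 m) ≡ true → (1 ≤ i) × (i ≤ m)
range1-bounds m i e rewrite range1≡interval m with interval-bounds 1 m i e
... | p , s≤s q = p , q

respectsP≡sameSet : ∀ I m φ → All (1 ≤_) I → (∀ i → elemᵇ i I ≡ true → i ≤ m) →
  length φ ≡ suc m → distinct φ ≡ true → respectsP I m φ ≡ sameSet (descents φ) I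
respectsP≡sameSet I m φ pos I≤m len dis = bool-ext respects⇒same same⇒respects
  where
  D = descents φ
  holds : ∀ i → 1 ≤ i → i ≤ m → _
  holds i p q = relation-holds I φ i p (subst (i <_) (sym len) (s≤s q)) dis
  respects⇒same : respectsP I m φ ≡ true → sameSet D I ≡ true
  respects⇒same e = ∧-intro (all-intro _ D D⊆I) (all-intro _ I I⊆D)
    where
    agree : ∀ i → 1 ≤ i → i ≤ m → elemᵇ i D ≡ elemᵇ i I
    agree i p q = proj₁ (holds i p q) (all-elim (relation I φ) (range1 m) i e (∈range1 m i p q))
    D⊆I : ∀ i → elemᵇ i D ≡ true → elemᵇ i I ≡ true
    D⊆I i ei with descent-range φ i ei
    ... | i≥1 , i<len = trans (sym (agree i i≥1 (ℕₚ.≤-pred (subst (i <_) len i<len)))) ei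
    I⊆D : ∀ i → elemᵇ i I ≡ true → elemᵇ i D ≡ true
    I⊆D i ei = trans (agree i (elemᵇ-All I i pos ei) (I≤m i ei)) ei
  same⇒respects : sameSet D I ≡ true → respectsP I m φ ≡ true
  same⇒respects e = all-intro (relation I φ) (range1 m) agree
    where
    agree : ∀ i → elemᵇ i (range1 m) ≡ true → relation I φ i ≡ true
    agree i ei with range1-bounds m i ei
    ... | i≥1 , i≤m = proj₂ (holds i i≥1 i≤m)
      (bool-ext (all-elim _ D i (∧-elimˡ e)) (all-elim _ I i (∧-elimʳ {all (λ a → elemᵇ a I) D} e)))

at-snoc : ∀ u z → at (u ∷ʳ z) (suc (length u)) ≡ z
at-snoc []          z = refl
at-snoc (a ∷ [])    z = refl
at-snoc (a ∷ b ∷ u) z = at-snoc (b ∷ u) z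

length-snoc : ∀ (u : List ℕ) z → length (u ∷ʳ z) ≡ suc (length u)
length-snoc u z = trans (Listₚ.length-++ u) (ℕₚ.+-comm (length u) 1)

h≡endingAt : ∀ I j → All (1 ≤_) I → j ≤ maxL I → h I j ≡ endingAt I (maxL I) (suc j)
h≡endingAt I j pos j≤m = begin
  h I j
    ≡⟨ countTuples-snoc m (range1 (suc m)) extension ⟩
  ∑ (range1 (suc m)) (λ z → countTuples m (range1 (suc m)) (λ u → extension (u ∷ʳ z)))
    ≡⟨ ∑-cong (range1 (suc m)) (λ z → trans (countTuples-ext m _ _ _ (as-permutation z))
                                             (countTuples-∧-const m _ (λ u → hasDescentSet I (u ∷ʳ z)) (z ∸ 1 ≡ᵇ j))) ⟩
  ∑ (range1 (suc m)) (λ z → if z ∸ 1 ≡ᵇ j then endingAt I m z else 0)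
    ≡⟨ cong (λ l → ∑ l (λ z → if z ∸ 1 ≡ᵇ j then endingAt I m z else 0)) (range1≡interval (suc m)) ⟩
  ∑ (interval 1 (suc m)) (λ z → if z ∸ 1 ≡ᵇ j then endingAt I m z else 0)
    ≡⟨ ∑-interval-shift 0 (suc m) _ ⟩
  ∑ (interval 0 (suc m)) (λ z → if z ≡ᵇ j then endingAt I m (suc z) else 0)
    ≡⟨ ∑-point 0 (suc m) j _ z≤n (s≤s j≤m) ⟩
  endingAt I m (suc j) ∎
  where
  open ≡-Reasoning
  m = maxL I
  extension : List ℕ → Bool
  extension φ = distinct φ ∧ respectsP I m φ ∧ (at φ (suc m) ∸ 1 ≡ᵇ j)
  as-permutation : ∀ z u → length u ≡ m → extension (u ∷ʳ z) ≡ (hasDescentSet I (u ∷ʳ z) ∧ (z ∸ 1 ≡ᵇ j))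
  as-permutation z u len rewrite subst (λ k → at (u ∷ʳ z) (suc k) ≡ z) len (at-snoc u z)
    with distinct (u ∷ʳ z) in dis
  ... | false = refl
  ... | true rewrite respectsP≡sameSet I m (u ∷ʳ z) pos (elemᵇ-≤maxL I)
                       (trans (length-snoc u z) (cong suc len)) dis = refl

kernel : ℕ → ℕ → ℕ → ℕ
kernel zero    X y = if y <ᵇ suc X then 1 else 0
kernel (suc t) X y = ∑ (interval 0 X) (λ x → kernel t x y)

kernel-1 : ∀ X y → kernel 1 X y ≡ X ∸ y
kernel-1 zero    y = sym (ℕₚ.0∸n≡0 y)
kernel-1 (suc X) y = trans (∑-interval-last 0 X (λ x → kernel 0 x y)) (add-last (y <ᵇ suc X) refl)
  where
  add-last : ∀ b → (y <ᵇ suc X) ≡ b → kernel 1 X y + (if b then 1 else 0) ≡ suc X ∸ y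
  add-last true  e = begin
    kernel 1 X y + 1 ≡⟨ cong (_+ 1) (kernel-1 X y) ⟩
    X ∸ y + 1        ≡⟨ sym (ℕₚ.+-∸-comm 1 (ℕₚ.≤-pred (<ᵇ-sound y (suc X) e))) ⟩
    X + 1 ∸ y        ≡⟨ cong (_∸ y) (ℕₚ.+-comm X 1) ⟩
    suc X ∸ y ∎
    where open ≡-Reasoning
  add-last false e = begin
    kernel 1 X y + 0 ≡⟨ ℕₚ.+-identityʳ _ ⟩
    kernel 1 X y     ≡⟨ kernel-1 X y ⟩
    X ∸ y            ≡⟨ ℕₚ.m≤n⇒m∸n≡0 (ℕₚ.m≤n⇒m≤1+n X<y) ⟩
    0                ≡⟨ sym (ℕₚ.m≤n⇒m∸n≡0 X<y) ⟩
    suc X ∸ y ∎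
    where
    open ≡-Reasoning
    X<y = <ᵇ-sound-≥ y (suc X) e

hockey-stick : ∀ t X y → ∑ (interval 0 X) (λ x → (x ∸ y) C suc t) ≡ (X ∸ y) C suc (suc t)
hockey-stick t zero    y rewrite ℕₚ.0∸n≡0 y = refl
hockey-stick t (suc X) y = begin
  ∑ (interval 0 (suc X)) (λ x → (x ∸ y) C suc t)      ≡⟨ ∑-interval-last 0 X (λ x → (x ∸ y) C suc t) ⟩
  ∑ (interval 0 X) (λ x → (x ∸ y) C suc t) + (X ∸ y) C suc t ≡⟨ cong (_+ (X ∸ y) C suc t) (hockey-stick t X y) ⟩
  (X ∸ y) C suc (suc t) + (X ∸ y) C suc t              ≡⟨ pascal (y ℕₚ.≤? X) ⟩
  (suc X ∸ y) C suc (suc t) ∎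
  where
  open ≡-Reasoning
  pascal : _ → (X ∸ y) C suc (suc t) + (X ∸ y) C suc t ≡ (suc X ∸ y) C suc (suc t)
  pascal (yes y≤X) = begin
    (X ∸ y) C suc (suc t) + (X ∸ y) C suc t  ≡⟨ ℕₚ.+-comm ((X ∸ y) C suc (suc t)) _ ⟩
    (X ∸ y) C suc t + (X ∸ y) C suc (suc t)  ≡⟨ nCk+nC[k+1]≡[n+1]C[k+1] (X ∸ y) (suc t) ⟩
    suc (X ∸ y) C suc (suc t)                ≡⟨ cong (_C suc (suc t)) (sym (ℕₚ.+-∸-assoc 1 y≤X)) ⟩
    (suc X ∸ y) C suc (suc t) ∎
  pascal (no y≰X) rewrite ℕₚ.m≤n⇒m∸n≡0 (ℕₚ.<⇒≤ (ℕₚ.≰⇒> y≰X)) | ℕₚ.m≤n⇒m∸n≡0 (ℕₚ.≰⇒> y≰X) = refl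

kernel-closed : ∀ t X y → kernel (suc t) X y ≡ (X ∸ y) C suc t
kernel-closed zero    X y = trans (kernel-1 X y) (sym (nC1≡n (X ∸ y)))
kernel-closed (suc t) X y = trans (∑-cong (interval 0 X) (λ x → kernel-closed t x y)) (hockey-stick t X y)

-- A triangle of numbers F t x (row t, column 1 ≤ x ≤ t+m+1) in which each entry is the sum
-- of the entries of the previous row strictly to its left.  Then every row sum is a
-- binomial combination of the initial row.
module PrefixSumTriangle (F : ℕ → ℕ → ℕ) (m : ℕ)
  (recursion : ∀ t x → 1 ≤ x → x ≤ suc (suc (t + m)) →
     F (suc t) x ≡ ∑ (interval 1 (suc (t + m))) (λ y → if y <ᵇ x then F t y else 0)) where

  prefix : ℕ → ℕ → ℕ
  prefix t X = ∑ (interval 1 X) (F t)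

  indicator : ∀ a b → a * (if b then 1 else 0) ≡ (if b then a else 0)
  indicator a true  = ℕₚ.*-identityʳ a
  indicator a false = ℕₚ.*-zeroʳ a

  prefix-kernel : ∀ t X → X ≤ suc (t + m) → prefix t X ≡ ∑ (interval 1 (suc m)) (λ y → F 0 y * kernel t X y)
  prefix-kernel zero X p = sym (trans (∑-cong (interval 1 (suc m)) (λ y → indicator (F 0 y) (y <ᵇ suc X)))
                                      (∑-below 1 (suc m) (suc X) (F 0) (s≤s z≤n) (s≤s p)))
  prefix-kernel (suc t) X p = begin
    ∑ (interval 1 X) (F (suc t))
      ≡⟨ ∑-interval-cong 1 X _ _ (λ x q1 q2 → recursion t x q1 (ℕₚ.≤-trans (ℕₚ.≤-pred q2) p)) ⟩
    ∑ (interval 1 X) (λ x → ∑ (interval 1 (suc (t + m))) (λ y → if y <ᵇ x then F t y else 0))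
      ≡⟨ ∑-interval-cong 1 X _ _ (λ x q1 q2 → ∑-below 1 (suc (t + m)) x (F t) q1 (ℕₚ.≤-trans (ℕₚ.≤-pred q2) p)) ⟩
    ∑ (interval 1 X) (λ x → prefix t (x ∸ 1))
      ≡⟨ ∑-interval-shift 0 X (λ x → prefix t (x ∸ 1)) ⟩
    ∑ (interval 0 X) (prefix t)
      ≡⟨ ∑-interval-cong 0 X _ _ (λ x _ q → prefix-kernel t x (ℕₚ.≤-pred (ℕₚ.≤-trans q p))) ⟩
    ∑ (interval 0 X) (λ x → ∑ (interval 1 (suc m)) (λ y → F 0 y * kernel t x y))
      ≡⟨ ∑-swap (interval 0 X) (interval 1 (suc m)) (λ x y → F 0 y * kernel t x y) ⟩
    ∑ (interval 1 (suc m)) (λ y → ∑ (interval 0 X) (λ x → F 0 y * kernel t x y))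
      ≡⟨ ∑-cong (interval 1 (suc m)) (λ y → sym (∑-*ˡ (interval 0 X) (F 0 y) (λ x → kernel t x y))) ⟩
    ∑ (interval 1 (suc m)) (λ y → F 0 y * kernel (suc t) X y) ∎
    where open ≡-Reasoning

  kernel-full-row : ∀ t y → 1 ≤ y → y ≤ suc m → kernel t (suc (t + m)) y ≡ (suc (t + m) ∸ y) C t
  kernel-full-row zero    y _ q rewrite <ᵇ-complete y (suc (suc m)) (s≤s q) = refl
  kernel-full-row (suc t) y _ _ = kernel-closed t (suc (suc (t + m))) y

  row-sum : ∀ t → prefix t (suc (t + m)) ≡ ∑ (interval 1 (suc m)) (λ y → F 0 y * ((suc (t + m) ∸ y) C t))
  row-sum t = trans (prefix-kernel t (suc (t + m)) ℕₚ.≤-refl)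
    (∑-interval-cong 1 (suc m) _ _ (λ y p q → cong (F 0 y *_) (kernel-full-row t y p (ℕₚ.≤-pred q))))

-- The table endingAt I (t+m) x is a prefix-sum triangle whose initial row is h, read backwards.
d-expansion : ∀ I → All (1 ≤_) I → ∀ t →
  d I (suc (t + maxL I)) ≡ ∑ (interval 0 (suc (maxL I))) (λ j → h I (maxL I ∸ j) * ((t + j) C j))
d-expansion I pos t = begin
  d I (suc (t + m))
    ≡⟨ d-by-last I (t + m) ⟩
  ∑ (range1 (suc (t + m))) (F t)
    ≡⟨ cong (λ l → ∑ l (F t)) (range1≡interval (suc (t + m))) ⟩
  prefix t (suc (t + m))
    ≡⟨ row-sum t ⟩
  ∑ (interval 1 (suc m)) (λ y → F 0 y * ((suc (t + m) ∸ y) C t))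
    ≡⟨ ∑-interval-reverse (suc m) _ ⟩
  ∑ (interval 0 (suc m)) (λ j → F 0 (suc m ∸ j) * ((suc (t + m) ∸ (suc m ∸ j)) C t))
    ≡⟨ ∑-interval-cong 0 (suc m) _ _ (λ j _ q → term j (ℕₚ.≤-pred q)) ⟩
  ∑ (interval 0 (suc m)) (λ j → h I (m ∸ j) * ((t + j) C j)) ∎
  where
  open ≡-Reasoning
  m = maxL I
  F : ℕ → ℕ → ℕ
  F r x = endingAt I (r + m) x
  recursion : ∀ r x → 1 ≤ x → x ≤ suc (suc (r + m)) →
    F (suc r) x ≡ ∑ (interval 1 (suc (r + m))) (λ y → if y <ᵇ x then F r y else 0)
  recursion r x p q = trans (endingAt-recursion I (r + m) x (s≤s (ℕₚ.m≤n+m m r)) p q)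
    (cong (λ l → ∑ l (λ y → if y <ᵇ x then F r y else 0)) (range1≡interval (suc (r + m))))
  open PrefixSumTriangle F m recursion
  term : ∀ j → j ≤ m → F 0 (suc m ∸ j) * ((suc (t + m) ∸ (suc m ∸ j)) C t) ≡ h I (m ∸ j) * ((t + j) C j)
  term j j≤m rewrite ℕₚ.+-∸-assoc 1 j≤m = cong₂ _*_ (sym (h≡endingAt I (m ∸ j) pos (ℕₚ.m∸n≤m m j))) binomial
    where
    binomial : ((t + m) ∸ (m ∸ j)) C t ≡ (t + j) C j
    binomial = begin
      ((t + m) ∸ (m ∸ j)) C t  ≡⟨ cong (_C t) (ℕₚ.+-∸-assoc t (ℕₚ.m∸n≤m m j)) ⟩
      (t + (m ∸ (m ∸ j))) C t  ≡⟨ cong (λ k → (t + k) C t) (ℕₚ.m∸[m∸n]≡n j≤m) ⟩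
      (t + j) C t              ≡⟨ nCk≡nC[n∸k] (ℕₚ.m≤m+n t j) ⟩
      (t + j) C (t + j ∸ t)    ≡⟨ cong ((t + j) C_) (ℕₚ.m+n∸m≡n t j) ⟩
      (t + j) C j ∎

ℕtoℚ-mkℚ : ∀ n → ℕtoℚ n ≡ mkℚ (ℤ.+ n) 0 (coprime-sym (1-coprimeTo n))
ℕtoℚ-mkℚ n = ℚₚ.normalize-coprime (coprime-sym (1-coprimeTo n))

ℕtoℚ-+ : ∀ a b → ℕtoℚ (a + b) ≡ ℕtoℚ a +ℚ ℕtoℚ b
ℕtoℚ-+ a b = trans (cong (_/ 1) (cong₂ ℤ._+_ (sym (ℤₚ.*-identityʳ (ℤ.+ a))) (sym (ℤₚ.*-identityʳ (ℤ.+ b)))))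
                   (sym (cong₂ _+ℚ_ (ℕtoℚ-mkℚ a) (ℕtoℚ-mkℚ b)))

ℕtoℚ-* : ∀ a b → ℕtoℚ (a * b) ≡ ℕtoℚ a *ℚ ℕtoℚ b
ℕtoℚ-* a b = trans (cong (_/ 1) (ℤₚ.pos-* a b)) (sym (cong₂ _*ℚ_ (ℕtoℚ-mkℚ a) (ℕtoℚ-mkℚ b)))

∑ℚ : ℕ → (ℕ → ℚ) → ℚ
∑ℚ zero    f = 0ℚ
∑ℚ (suc K) f = f 0 +ℚ ∑ℚ K (λ j → f (suc j))

∑ℚ-cong : ∀ K (f g : ℕ → ℚ) → (∀ j → j < K → f j ≡ g j) → ∑ℚ K f ≡ ∑ℚ K g
∑ℚ-cong zero    f g _ = refl
∑ℚ-cong (suc K) f g h = cong₂ _+ℚ_ (h 0 (s≤s z≤n)) (∑ℚ-cong K _ _ (λ j p → h (suc j) (s≤s p)))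

∑ℚ-+ : ∀ K (f g : ℕ → ℚ) → ∑ℚ K (λ j → f j +ℚ g j) ≡ ∑ℚ K f +ℚ ∑ℚ K g
∑ℚ-+ zero    f g = sym (ℚₚ.+-identityʳ 0ℚ)
∑ℚ-+ (suc K) f g = trans (cong (f 0 +ℚ g 0 +ℚ_) (∑ℚ-+ K _ _)) (+ℚ-interchange (f 0) (g 0) _ _)

sumℚ-interval : ∀ K a (f : ℕ → ℚ) → sumℚ (map f (interval a K)) ≡ ∑ℚ K (λ j → f (a + j))
sumℚ-interval zero    a f = refl
sumℚ-interval (suc K) a f = cong₂ _+ℚ_ (cong f (sym (ℕₚ.+-identityʳ a)))
  (trans (sumℚ-interval K (suc a) f) (∑ℚ-cong K _ _ (λ j _ → cong f (sym (ℕₚ.+-suc a j)))))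

ℕtoℚ-∑ : ∀ xs (f : ℕ → ℕ) → ℕtoℚ (∑ xs f) ≡ sumℚ (map (λ x → ℕtoℚ (f x)) xs)
ℕtoℚ-∑ []       f = refl
ℕtoℚ-∑ (x ∷ xs) f = trans (ℕtoℚ-+ (f x) _) (cong (ℕtoℚ (f x) +ℚ_) (ℕtoℚ-∑ xs f))

combination : ℕ → (ℕ → ℚ) → ℕ → ℚ
combination K a t = ∑ℚ K (λ j → a j *ℚ ℕtoℚ ((t + j) C j))

-- Pascal's rule gives a difference equation: the forward difference in t of a combination
-- with coefficients a_0, a_1, … is the combination with the shifted coefficients a_1, a_2, ….
combination-difference : ∀ K a t →
  combination (suc K) a (suc t) ≡ combination (suc K) a t +ℚ combination K (λ j → a (suc j)) (suc t)
combination-difference K a t = begin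
  a 0 *ℚ ℕtoℚ 1 +ℚ ∑ℚ K (λ j → a (suc j) *ℚ binom (suc t + suc j) (suc j))
    ≡⟨ cong (a 0 *ℚ ℕtoℚ 1 +ℚ_) (trans (∑ℚ-cong K _ _ (λ j _ → pascal j)) (∑ℚ-+ K _ _)) ⟩
  a 0 *ℚ ℕtoℚ 1 +ℚ (∑ℚ K (λ j → a (suc j) *ℚ binom (t + suc j) (suc j)) +ℚ ∑ℚ K (λ j → a (suc j) *ℚ binom (suc t + j) j))
    ≡⟨ sym (ℚₚ.+-assoc (a 0 *ℚ ℕtoℚ 1) _ _) ⟩
  combination (suc K) a t +ℚ combination K (λ j → a (suc j)) (suc t) ∎
  where
  open ≡-Reasoning
  binom : ℕ → ℕ → ℚ
  binom n k = ℕtoℚ (n C k)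
  pascalℕ : ∀ j → (suc t + suc j) C suc j ≡ (t + suc j) C suc j + (suc t + j) C j
  pascalℕ j = begin
    suc (t + suc j) C suc j                       ≡⟨ sym (nCk+nC[k+1]≡[n+1]C[k+1] (t + suc j) j) ⟩
    (t + suc j) C j + (t + suc j) C suc j         ≡⟨ ℕₚ.+-comm ((t + suc j) C j) _ ⟩
    (t + suc j) C suc j + (t + suc j) C j         ≡⟨ cong (λ w → (t + suc j) C suc j + w C j) (ℕₚ.+-suc t j) ⟩
    (t + suc j) C suc j + (suc t + j) C j ∎
  pascal : ∀ j → a (suc j) *ℚ binom (suc t + suc j) (suc j)
               ≡ a (suc j) *ℚ binom (t + suc j) (suc j) +ℚ a (suc j) *ℚ binom (suc t + j) j
  pascal j = trans (cong (λ z → a (suc j) *ℚ z) (trans (cong ℕtoℚ (pascalℕ j)) (ℕtoℚ-+ ((t + suc j) C suc j) ((suc t + j) C j))))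
                   (ℚₚ.*-distribˡ-+ (a (suc j)) _ _)

combination-injective : ∀ K (a b : ℕ → ℚ) s → (∀ t → s ≤ t → combination K a t ≡ combination K b t) →
  ∀ j → j < K → a j ≡ b j
combination-injective (suc K) a b s agree = coefficient
  where
  a′ b′ : ℕ → ℚ
  a′ j = a (suc j)
  b′ j = b (suc j)
  differences-agree : ∀ t → suc s ≤ t → combination K a′ t ≡ combination K b′ t
  differences-agree (suc t) (s≤s p) = +ℚ-cancelˡ (combination (suc K) a t) _ _ (begin
    combination (suc K) a t +ℚ combination K a′ (suc t) ≡⟨ sym (combination-difference K a t) ⟩
    combination (suc K) a (suc t)                       ≡⟨ agree (suc t) (ℕₚ.m≤n⇒m≤1+n p) ⟩
    combination (suc K) b (suc t)                       ≡⟨ combination-difference K b t ⟩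
    combination (suc K) b t +ℚ combination K b′ (suc t) ≡⟨ cong (_+ℚ combination K b′ (suc t)) (sym (agree t p)) ⟩
    combination (suc K) a t +ℚ combination K b′ (suc t) ∎)
    where open ≡-Reasoning
  shifted : ∀ j → j < K → a (suc j) ≡ b (suc j)
  shifted = combination-injective K a′ b′ (suc s) differences-agree
  constant-term : a 0 *ℚ 1ℚ ≡ b 0 *ℚ 1ℚ
  constant-term = +ℚ-cancelʳ _ _ _ (trans (agree s ℕₚ.≤-refl)
    (cong (b 0 *ℚ 1ℚ +ℚ_) (∑ℚ-cong K _ _ (λ j p → cong (_*ℚ ℕtoℚ ((s + suc j) C suc j)) (sym (shifted j p))))))
  coefficient : ∀ j → j < suc K → a j ≡ b j
  coefficient zero    _       = trans (sym (ℚₚ.*-identityʳ (a 0))) (trans constant-term (ℚₚ.*-identityʳ (b 0)))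
  coefficient (suc j) (s≤s p) = shifted j p

expansion-sum : ∀ m (a : ℕ → ℚ) t →
  sumℚ (map (λ j → a j *ℚ ℕtoℚ ((((suc (t + m) ∸ m) + j) ∸ 1) C j)) (upTo (suc m))) ≡ combination (suc m) a t
expansion-sum m a t = begin
  sumℚ (map term (upTo (suc m)))          ≡⟨ cong (λ l → sumℚ (map term l)) (upTo≡interval (suc m)) ⟩
  sumℚ (map term (interval 0 (suc m)))    ≡⟨ sumℚ-interval (suc m) 0 term ⟩
  ∑ℚ (suc m) term                         ≡⟨ ∑ℚ-cong (suc m) _ _ (λ j _ → cong (λ z → a j *ℚ ℕtoℚ (((z + j) ∸ 1) C j)) (ℕₚ.m+n∸n≡m (suc t) m)) ⟩
  combination (suc m) a t ∎
  where
  open ≡-Reasoning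
  term : ℕ → ℚ
  term j = a j *ℚ ℕtoℚ ((((suc (t + m) ∸ m) + j) ∸ 1) C j)

coefficients : List ℕ → ℕ → ℚ
coefficients I j = ℕtoℚ (h I (maxL I ∸ j))

d-combination : ∀ I → All (1 ≤_) I → ∀ t →
  ℕtoℚ (d I (suc (t + maxL I))) ≡ combination (suc (maxL I)) (coefficients I) t
d-combination I pos t = begin
  ℕtoℚ (d I (suc (t + m)))                                  ≡⟨ cong ℕtoℚ (d-expansion I pos t) ⟩
  ℕtoℚ (∑ (interval 0 (suc m)) term)                       ≡⟨ ℕtoℚ-∑ (interval 0 (suc m)) term ⟩
  sumℚ (map (λ j → ℕtoℚ (term j)) (interval 0 (suc m)))   ≡⟨ sumℚ-interval (suc m) 0 (λ j → ℕtoℚ (term j)) ⟩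
  ∑ℚ (suc m) (λ j → ℕtoℚ (term j))                         ≡⟨ ∑ℚ-cong (suc m) _ _ (λ j _ → ℕtoℚ-* (h I (m ∸ j)) ((t + j) C j)) ⟩
  combination (suc m) (coefficients I) t ∎
  where
  open ≡-Reasoning
  m = maxL I
  term : ℕ → ℕ
  term j = h I (m ∸ j) * ((t + j) C j)

above : ∀ m n → suc m ≤ n → Σ ℕ (λ t → n ≡ suc (t + m))
above m n p = n ∸ suc m , trans (sym (ℕₚ.m∸n+n≡m p)) (ℕₚ.+-suc (n ∸ suc m) m)

expansion-exists : ∀ I → All (1 ≤_) I → Expansion I (coefficients I)
expansion-exists I pos n n>m = at-shape n (above (maxL I) n n>m)
  where
  at-shape : ∀ n → Σ ℕ (λ t → n ≡ suc (t + maxL I)) → ℕtoℚ (d I n) ≡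
    sumℚ (map (λ j → coefficients I j *ℚ ℕtoℚ ((((n ∸ maxL I) + j) ∸ 1) C j)) (upTo (suc (maxL I))))
  at-shape .(suc (t + maxL I)) (t , refl) =
    trans (d-combination I pos t) (sym (expansion-sum (maxL I) (coefficients I) t))

expansion-unique : ∀ I → All (1 ≤_) I → (a : ℕ → ℚ) → Expansion I a → ∀ j → j ≤ maxL I → a j ≡ coefficients I j
expansion-unique I pos a expansion j j≤m = combination-injective (suc m) a (coefficients I) 0 agree j (s≤s j≤m)
  where
  m = maxL I
  agree : ∀ t → 0 ≤ t → combination (suc m) a t ≡ combination (suc m) (coefficients I) t
  agree t _ = trans (sym (expansion-sum m a t))
                    (trans (sym (expansion (suc (t + m)) (s≤s (ℕₚ.m≤n+m m t)))) (d-combination I pos t))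

-- Proposition 4.1.
proposition4p1 : (I : List ℕ) → All (λ i → 1 ≤ i) I → I ≢ [] →
    Σ (ℕ → ℚ) (λ a → Expansion I a)
    × ((a : ℕ → ℚ) → Expansion I a →
         (k : ℕ) → k < maxL I → a (suc k) ≡ ℕtoℚ (h I (maxL I ∸ k ∸ 1)))
proposition4p1 I pos _ = (coefficients I , expansion-exists I pos) , identify
  where
  identify : (a : ℕ → ℚ) → Expansion I a → (k : ℕ) → k < maxL I → a (suc k) ≡ ℕtoℚ (h I (maxL I ∸ k ∸ 1))
  identify a expansion k k<m = begin
    a (suc k)                        ≡⟨ expansion-unique I pos a expansion (suc k) k<m ⟩
    ℕtoℚ (h I (maxL I ∸ suc k))      ≡⟨ cong (λ i → ℕtoℚ (h I (maxL I ∸ i))) (ℕₚ.+-comm 1 k) ⟩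
    ℕtoℚ (h I (maxL I ∸ (k + 1)))    ≡⟨ cong (λ i → ℕtoℚ (h I i)) (sym (ℕₚ.∸-+-assoc (maxL I) k 1)) ⟩
    ℕtoℚ (h I (maxL I ∸ k ∸ 1)) ∎
    where open ≡-Reasoning
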